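{- Let $K$ be a set of ground types, let $\mathcal M$ and $\mathcal N$ be type frames over $K$, and let $\mathrm R=(\mathrm R_\sigma)_\sigma$ be a binary pre-logical relation between $\mathcal M$ and $\mathcal N$. Suppose that for every ground type $\kappa\in K$ the relation $\mathrm R_\kappa$ is a partial function (i.e. $(x,y),(x,y')\in\mathrm R_\kappa$ implies $y=y'$), and that for every simple type $\sigma$ the relation $\mathrm R_\sigma$ is surjective (i.e. for every $y\in\mathcal N_\sigma$ there is $x\in\mathcal M_\sigma$ with $(x,y)\in\mathrm R_\sigma$). Then $\mathrm R$ is a pre-logical surjection, i.e. in addition $\mathrm R_\sigma$ is a partial function for every simple type $\sigma$.
   Context: Simple types over a set $K$ of ground types form the smallest set containing $K$ and closed under $\sigma,\tau\mapsto\sigma\to\tau$. A type frame $\mathcal M$ over $K$ is a family of sets $(\mathcal M_\sigma)$ indexed by simple types such that $\mathcal M_{\sigma\to\tau}$ is a set of (set-theoretic) functions from $\mathcal M_\sigma$ to $\mathcal M_\tau$. Terms of the pure simply typed $\lambda$-calculus $\Lambda$ over $K$ (no constants) are interpreted in a type frame relative to an environment $\rho$ (a type-respecting assignment of elements to variables) by $[\![x]\!]_\rho=\rho(x)$, $[\![PQ]\!]_\rho=[\![P]\!]_\rho([\![Q]\!]_\rho)$, $[\![\lambda x{:}\sigma.P]\!]_\rho=(d\in\mathcal M_\sigma\mapsto[\![P]\!]_{\rho[x:=d]})$. A binary pre-logical relation between type frames $\mathcal M,\mathcal N$ over $K$ is a family $\mathrm R_\sigma\subseteq\mathcal M_\sigma\times\mathcal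 N_\sigma$ such that: (1) if $(f,g)\in\mathrm R_{\sigma\to\tau}$ then for all $(x,y)\in\mathrm R_\sigma$, $(f(x),g(y))\in\mathrm R_\tau$; (2) for every term $P$ of $\Lambda$ of type $\tau$, every variable $z{:}\sigma$, every $\mathcal M$-environment $\rho$ and $\mathcal N$-environment $\rho'$ with $(\rho(x),\rho'(x))\in\mathrm R_\delta$ for every variable $x{:}\delta$: if $([\![P]\!]^{\mathcal M}_{\rho[z:=a]},[\![P]\!]^{\mathcal N}_{\rho'[z:=b]})\in\mathrm R_\tau$ for all $(a,b)\in\mathrm R_\sigma$, then $([\![\lambda z.P]\!]^{\mathcal M}_\rho,[\![\lambda z.P]\!]^{\mathcal N}_{\rho'})\in\mathrm R_{\sigma\to\tau}$. A pre-logical surjection is a pre-logical relation which at every type is both surjective and a partial function. -}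

module Defs where

open import Data.List using (List; []; _∷_)
open import Data.Product using (_×_; Σ; _,_)
open import Relation.Binary.PropositionalEquality using (_≡_)

data Ty (K : Set) : Set where
  base : K → Ty K
  _⇒_  : Ty K → Ty K → Ty K

infixr 7 _⇒_

-- Elements of M (σ ⇒ τ) are given together with
-- their action `ap`; being *set-theoretic functions* means that an element
-- is determined by its graph (extensionality of `ap`).
record TypeFrame (K : Set) : Set₁ where
  field
    El  : Ty K → Set
    ap  : ∀ {σ τ} → El (σ ⇒ τ) → El σ → El τ
    ext : ∀ {σ τ} (f g : El (σ ⇒ τ)) → (∀ x → ap f x ≡ ap g x) → f ≡ g
open TypeFrame public

Ctx : Set → Set
Ctx K = List (Ty K)

data Var {K : Set} : Ctx K → Ty K → Set where
  vz : ∀ {Γ σ} → Var (σ ∷ Γ) σ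
  vs : ∀ {Γ σ τ} → Var Γ σ → Var (τ ∷ Γ) σ

data Tm {K : Set} (Γ : Ctx K) : Ty K → Set where
  var : ∀ {σ} → Var Γ σ → Tm Γ σ
  app : ∀ {σ τ} → Tm Γ (σ ⇒ τ) → Tm Γ σ → Tm Γ τ
  lam : ∀ {σ τ} → Tm (σ ∷ Γ) τ → Tm Γ (σ ⇒ τ)

Env : ∀ {K} → TypeFrame K → Ctx K → Set
Env M Γ = ∀ {σ} → Var Γ σ → El M σ

extend : ∀ {K} {M : TypeFrame K} {Γ σ} → Env M Γ → El M σ → Env M (σ ∷ Γ)
extend ρ d vz     = d
extend ρ d (vs x) = ρ x

-- Interpretation ⟦P⟧ρ, as the graph  ⟦ P ⟧ ρ ↦ d  (the meaning of λz.P exists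
-- only if the function d ↦ ⟦P⟧ρ[z:=d] belongs to the frame; by extensionality
-- the meaning is unique when it exists).
data Eval {K : Set} (M : TypeFrame K) {Γ : Ctx K} :
       ∀ {σ} → Tm Γ σ → Env M Γ → El M σ → Set

syntax Eval M P ρ d = ⟦ P ⟧[ M ] ρ ↦ d

data Eval {K} M {Γ} where
  ev-var : ∀ {σ} {x : Var Γ σ} {ρ : Env M Γ} → ⟦ var x ⟧[ M ] ρ ↦ ρ x
  ev-app : ∀ {σ τ} {P : Tm Γ (σ ⇒ τ)} {Q : Tm Γ σ} {ρ : Env M Γ} {f d} →
           ⟦ P ⟧[ M ] ρ ↦ f → ⟦ Q ⟧[ M ] ρ ↦ d → ⟦ app P Q ⟧[ M ] ρ ↦ ap M f d
  ev-lam : ∀ {σ τ} {P : Tm (σ ∷ Γ) τ} {ρ : Env M Γ} {f : El M (σ ⇒ τ)} →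
           (∀ d → ⟦ P ⟧[ M ] extend {M = M} ρ d ↦ ap M f d) → ⟦ lam P ⟧[ M ] ρ ↦ f

Rel : ∀ {K} → TypeFrame K → TypeFrame K → Set₁
Rel {K} M N = (σ : Ty K) → El M σ → El N σ → Set

record PreLogical {K : Set} (M N : TypeFrame K) (R : Rel M N) : Set where
  field
    app-closed : ∀ {σ τ} (f : El M (σ ⇒ τ)) (g : El N (σ ⇒ τ)) →
      R (σ ⇒ τ) f g → ∀ x y → R σ x y → R τ (ap M f x) (ap N g y)
    lam-closed : ∀ {Γ σ τ} (P : Tm (σ ∷ Γ) τ) (ρ : Env M Γ) (ρ' : Env N Γ) →
      (∀ {δ} (x : Var Γ δ) → R δ (ρ x) (ρ' x)) →
      (∀ a b → R σ a b → ∀ d e →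
         ⟦ P ⟧[ M ] extend {M = M} ρ a ↦ d → ⟦ P ⟧[ N ] extend {M = N} ρ' b ↦ e →
         R τ d e) →
      ∀ f g → ⟦ lam P ⟧[ M ] ρ ↦ f → ⟦ lam P ⟧[ N ] ρ' ↦ g → R (σ ⇒ τ) f g

PartialFunction : ∀ {A B : Set} → (A → B → Set) → Set
PartialFunction {A} {B} r = ∀ (x : A) (y y' : B) → r x y → r x y' → y ≡ y'

Surjective : ∀ {A B : Set} → (A → B → Set) → Set
Surjective {A} {B} r = ∀ (y : B) → Σ A (λ x → r x y)

PreLogicalSurjection : ∀ {K} (M N : TypeFrame K) → Rel M N → Set
PreLogicalSurjection {K} M N R =
  PreLogical M N R × ((σ : Ty K) → Surjective (R σ) × PartialFunction (R σ))

module Submission where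

open import Defs
open import Data.Product using (_×_; _,_)
open import Relation.Binary.PropositionalEquality using (_≡_)

module _ {K : Set} (M N : TypeFrame K) (R : Rel M N)
         (app-closed : ∀ {σ τ} (f : El M (σ ⇒ τ)) (g : El N (σ ⇒ τ)) →
           R (σ ⇒ τ) f g → ∀ x y → R σ x y → R τ (ap M f x) (ap N g y))
         (surjective : (σ : Ty K) → Surjective (R σ))
         (base-partial : (κ : K) → PartialFunction (R (base κ))) where

  -- If f R g and f R g', pick x R y by surjectivity for each y: closure under
  -- application gives f x R g y and f x R g' y, so g y ≡ g' y by induction at
  -- the codomain, and g ≡ g' by extensionality of N.
  partialFunction : (σ : Ty K) → PartialFunction (R σ)
  partialFunction (base κ) = base-partial κ
  partialFunction (σ ⇒ τ) f g g' fRg fRg' = ext N g g' pointwise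
    where
    pointwise : ∀ y → ap N g y ≡ ap N g' y
    pointwise y with surjective σ y
    ... | x , xRy = partialFunction τ (ap M f x) (ap N g y) (ap N g' y)
                      (app-closed f g fRg x y xRy) (app-closed f g' fRg' x y xRy)

lemma3p7 : (K : Set) (M N : TypeFrame K) (R : Rel M N) →
    PreLogical M N R →
    ((κ : K) → PartialFunction (R (base κ))) →
    ((σ : Ty K) → Surjective (R σ)) →
    PreLogicalSurjection M N R
lemma3p7 K M N R preLogical base-partial surjective =
  preLogical , λ σ → surjective σ , partialFunction M N R app-closed surjective base-partial σ
  where open PreLogical preLogical
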